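{- Let $d,k,t$ be positive integers with $\gcd(k,d)=1$ and $t\ge 3$, and let $(G,\sigma)$ be a signed graph. If $(G,\sigma)$ has a $(tk,td)$-coloring, then it has a $(tk-2k,\,td-2d)$-coloring.
   Context: Graphs are simple and finite. A signed graph $(G,\sigma)$ is a graph $G$ with a map $\sigma:E(G)\to\{\pm1\}$. For $x\in\mathbb{R}$ and $r>0$, $[x]_r\in[0,r)$ is the remainder of $x$ modulo $r$ and $|x|_r=\min\{[x]_r,[-x]_r\}$. For positive integers $k\ge 2d$, a $(k,d)$-coloring of $(G,\sigma)$ is a map $c:V(G)\to\mathbb{Z}_k$ such that $|c(v)-\sigma(e)c(w)|_k\ge d$ for every edge $e=vw$. -}

module Defs where

open import Data.Nat using (ℕ; zero; suc; _⊔_; _⊓_; _≤_)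
open import Data.Integer as ℤ using (ℤ; +_; -_; _-_)
open import Data.Integer.DivMod using (_%ℕ_)
open import Data.Fin using (Fin; toℕ)
open import Data.Product using (Σ)
open import Relation.Binary.PropositionalEquality using (_≡_)
open import Relation.Nullary using (¬_)

data Sign : Set where
  plus minus : Sign

_·_ : Sign → ℤ → ℤ
plus  · x = x
minus · x = - x

-- [x]_r : remainder of x modulo r, in [0, r) (r = 0 never used; returns 0)
[_]_ : ℤ → ℕ → ℕ
[ x ] zero    = 0
[ x ] (suc r) = x %ℕ suc r

∣_∣_ : ℤ → ℕ → ℕ
∣ x ∣ r = ([ x ] r) ⊓ ([ - x ] r)

record SignedGraph : Set₁ where
  field
    n      : ℕ
    Adj    : Fin n → Fin n → Set
    sym    : ∀ {v w} → Adj v w → Adj w v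
    irrefl : ∀ {v} → ¬ Adj v v
    σ      : ∀ {v w} → Adj v w → Sign
    σ-sym  : ∀ {v w} (e : Adj v w) → σ (sym e) ≡ σ e

open SignedGraph public

IsKDColoring : (G : SignedGraph) (k d : ℕ) → (Fin (n G) → Fin k) → Set
IsKDColoring G k d c =
  ∀ {v w} (e : Adj G v w) →
    d ≤ ∣ (+ toℕ (c v)) - (σ G e · (+ toℕ (c w))) ∣ k

HasKDColoring : (G : SignedGraph) (k d : ℕ) → Set
HasKDColoring G k d = Σ (Fin (n G) → Fin k) (IsKDColoring G k d)

-- Write t = s + 2 and let g : ℤ → ℤ send q t + r (0 ≤ r < t) to q s + max (r − 1) 0: it merges
-- the residues 0 and 1 of every block of t consecutive integers.  Then g is monotone, odd, and
-- g (x + t m) = g x + s m.  If c is a (tk, td)-colouring, then g ∘ c taken mod sk is an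
-- (sk, sd)-colouring: an edge vw says c v − σ c w ≡ y (mod tk) with td ≤ y ≤ tk − td, so with
-- z = σ c w monotonicity and periodicity put g (z + y) − g z between sd and sk − sd, and oddness
-- turns g z into σ g (c w).
module Submission where

open import Defs hiding (sym)
open import Data.Nat using (ℕ)
open import Data.Product using (∃₂; _×_; _,_; proj₁; proj₂)
open import Relation.Binary.PropositionalEquality
  using (_≡_; refl; sym; trans; cong; cong₂; subst; subst₂; module ≡-Reasoning)

module Residues where

  open import Data.Nat as ℕ using (NonZero; _⊓_)
  import Data.Nat.Properties as ℕ
  open import Data.Integer using (ℤ; +_; -_; _+_; _-_; _*_; _≤_; _<_; +≤+; +<+; suc; 0ℤ; -1ℤ)
  open import Data.Integer.Properties
  open import Data.Integer.DivMod using (_%ℕ_; _/ℕ_; a≡a%ℕn+[a/ℕn]*n; n%ℕd<d)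
  open import Data.Integer.Tactic.RingSolver using (solve-∀)
  open import Algebra.Properties.AbelianGroup +-0-abelianGroup
    using () renaming (∙-cancelʳ to +-cancelʳ-≡)

  +[n∸m]≡+n-+m : ∀ {m n} → m ℕ.≤ n → + (n ℕ.∸ m) ≡ + n - + m
  +[n∸m]≡+n-+m {m} {n} m≤n = sym (trans (m-n≡m⊖n n m) (≤-⊖ m≤n))

  -[r+qK]≡[K∸r]+[-1-q]K : ∀ {K r} q → r ℕ.≤ K →
    - (+ r + q * + K) ≡ + (K ℕ.∸ r) + (-1ℤ - q) * + K
  -[r+qK]≡[K∸r]+[-1-q]K {K} {r} q r≤K = begin
    - (+ r + q * + K)               ≡⟨ reflect (+ r) q (+ K) ⟩
    + K - + r + (-1ℤ - q) * + K     ≡⟨ cong (_+ (-1ℤ - q) * + K) (+[n∸m]≡+n-+m r≤K) ⟨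
    + (K ℕ.∸ r) + (-1ℤ - q) * + K   ∎
    where
    open ≡-Reasoning
    reflect : ∀ a q k → - (a + q * k) ≡ k - a + (-1ℤ - q) * k
    reflect = solve-∀

  InArc : ℤ → ℤ → ℤ → Set
  InArc K d x = ∃₂ λ w q → x ≡ w + q * K × d ≤ w × w + d ≤ K

  InArc-shift : ∀ {K d x} p → InArc K d x → InArc K d (x + p * K)
  InArc-shift {K} p (w , q , refl , d≤w , w+d≤K) = w , q + p , regroup w q p K , d≤w , w+d≤K
    where
    regroup : ∀ w q p k → w + q * k + p * k ≡ w + (q + p) * k
    regroup = solve-∀

  InArc-between : ∀ {K d a b} → a + d ≤ b → b + d ≤ a + K → InArc K d (b - a)
  InArc-between {K} {d} {a} {b} a+d≤b b+d≤a+K =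
    b - a , 0ℤ , sym (+-identityʳ (b - a)) , d≤b-a , b-a+d≤K
    where
    open ≤-Reasoning
    a+x-a≡x : ∀ a x → a + x - a ≡ x
    a+x-a≡x = solve-∀
    [b-a]+d≡[b+d]-a : ∀ b a d → b - a + d ≡ b + d - a
    [b-a]+d≡[b+d]-a = solve-∀
    d≤b-a : d ≤ b - a
    d≤b-a = begin
      d             ≡⟨ a+x-a≡x a d ⟨
      a + d - a     ≤⟨ +-monoˡ-≤ (- a) a+d≤b ⟩
      b - a         ∎
    b-a+d≤K : b - a + d ≤ K
    b-a+d≤K = begin
      b - a + d     ≡⟨ [b-a]+d≡[b+d]-a b a d ⟩
      b + d - a     ≤⟨ +-monoˡ-≤ (- a) b+d≤a+K ⟩
      a + K - a     ≡⟨ a+x-a≡x a K ⟩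
      K             ∎

  [x]≡x%ℕ : ∀ K .{{_ : NonZero K}} x → [ x ] K ≡ x %ℕ K
  [x]≡x%ℕ (ℕ.suc K) x = refl

  module _ {K : ℕ} .{{_ : NonZero K}} where

    division : ∀ x → ∃₂ λ r q → r ℕ.< K × x ≡ + r + q * + K
    division x = x %ℕ K , x /ℕ K , n%ℕd<d x K , a≡a%ℕn+[a/ℕn]*n x K

    quotient-≤ : ∀ {r r′ q q′} → r′ ℕ.< K → + r + q * + K ≡ + r′ + q′ * + K → q ≤ q′
    quotient-≤ {r} {r′} {q} {q′} r′<K eq = subst (q ≤_) (pred-suc q′) (i<j⇒i≤pred[j] q<1+q′)
      where
      open ≤-Reasoning
      q<1+q′ : q < suc q′
      q<1+q′ = *-cancelʳ-<-nonNeg (+ K) (begin-strict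
        q * + K          ≤⟨ i≤j+i (q * + K) (+ r) ⟩
        + r + q * + K    ≡⟨ eq ⟩
        + r′ + q′ * + K  <⟨ +-monoˡ-< (q′ * + K) (+<+ r′<K) ⟩
        + K + q′ * + K   ≡⟨ suc-* q′ (+ K) ⟨
        suc q′ * + K     ∎)

    division-unique : ∀ {r r′ q q′} → r ℕ.< K → r′ ℕ.< K →
      + r + q * + K ≡ + r′ + q′ * + K → r ≡ r′ × q ≡ q′
    division-unique {r} {r′} {q} {q′} r<K r′<K eq =
      +-injective (+-cancelʳ-≡ (q′ * + K) (+ r) (+ r′) eq′) , q≡q′
      where
      q≡q′ = ≤-antisym (quotient-≤ r′<K eq) (quotient-≤ r<K (sym eq))
      eq′ : + r + q′ * + K ≡ + r′ + q′ * + K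
      eq′ = subst (λ p → + r + p * + K ≡ + r′ + q′ * + K) q≡q′ eq

    [r+qK]%ℕK≡r : ∀ {r} q → r ℕ.< K → (+ r + q * + K) %ℕ K ≡ r
    [r+qK]%ℕK≡r {r} q r<K =
      sym (proj₁ (division-unique {q = q} {q′ = x /ℕ K} r<K (n%ℕd<d x K) (a≡a%ℕn+[a/ℕn]*n x K)))
      where x = + r + q * + K

    [r+qK]/ℕK≡q : ∀ {r} q → r ℕ.< K → (+ r + q * + K) /ℕ K ≡ q
    [r+qK]/ℕK≡q {r} q r<K =
      sym (proj₂ (division-unique {q = q} {q′ = x /ℕ K} r<K (n%ℕd<d x K) (a≡a%ℕn+[a/ℕn]*n x K)))
      where x = + r + q * + K

    ∣x∣≡x%ℕK⊓-x%ℕK : ∀ x → ∣ x ∣ K ≡ (x %ℕ K) ⊓ ((- x) %ℕ K)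
    ∣x∣≡x%ℕK⊓-x%ℕK x = cong₂ _⊓_ ([x]≡x%ℕ K x) ([x]≡x%ℕ K (- x))

    ∣r+qK∣≡r⊓[K∸r] : ∀ {r} q → 0 ℕ.< r → r ℕ.< K → ∣ + r + q * + K ∣ K ≡ r ⊓ (K ℕ.∸ r)
    ∣r+qK∣≡r⊓[K∸r] {r} q 0<r r<K =
      trans (∣x∣≡x%ℕK⊓-x%ℕK (+ r + q * + K)) (cong₂ _⊓_ ([r+qK]%ℕK≡r q r<K) -[r+qK]%ℕK≡K∸r)
      where
      -[r+qK]%ℕK≡K∸r : (- (+ r + q * + K)) %ℕ K ≡ K ℕ.∸ r
      -[r+qK]%ℕK≡K∸r = trans (cong (_%ℕ K) (-[r+qK]≡[K∸r]+[-1-q]K q (ℕ.<⇒≤ r<K)))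
                             ([r+qK]%ℕK≡r (-1ℤ - q) (ℕ.∸-monoʳ-< 0<r (ℕ.<⇒≤ r<K)))

    ≤∣x∣⇒InArc : ∀ {d} x → d ℕ.≤ ∣ x ∣ K → InArc (+ K) (+ d) x
    ≤∣x∣⇒InArc {d} x d≤∣x∣ with division x
    ... | ℕ.zero , q , 0<K , refl = + 0 , q , refl , +≤+ d≤0 , +≤+ (ℕ.≤-trans d≤0 ℕ.z≤n)
      where
      d≤0 : d ℕ.≤ 0
      d≤0 = ℕ.≤-trans d≤∣x∣ (ℕ.≤-trans (ℕ.≤-reflexive (∣x∣≡x%ℕK⊓-x%ℕK x))
                                        (ℕ.≤-trans (ℕ.m⊓n≤m _ _) (ℕ.≤-reflexive ([r+qK]%ℕK≡r q 0<K))))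
    ... | r@(ℕ.suc _) , q , r<K , refl = + r , q , refl , +≤+ d≤r , +≤+ r+d≤K
      where
      d≤r⊓K∸r : d ℕ.≤ r ⊓ (K ℕ.∸ r)
      d≤r⊓K∸r = subst (d ℕ.≤_) (∣r+qK∣≡r⊓[K∸r] q ℕ.z<s r<K) d≤∣x∣
      d≤r = ℕ.≤-trans d≤r⊓K∸r (ℕ.m⊓n≤m r _)
      d≤K∸r = ℕ.≤-trans d≤r⊓K∸r (ℕ.m⊓n≤n r _)
      r+d≤K = subst (ℕ._≤ K) (ℕ.+-comm d r) (ℕ.m≤o∸n⇒m+n≤o d (ℕ.<⇒≤ r<K) d≤K∸r)

    InArc⇒≤∣x∣ : ∀ {d x} → 0 ℕ.< d → InArc (+ K) (+ d) x → d ℕ.≤ ∣ x ∣ K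
    InArc⇒≤∣x∣ {d} 0<d (+ u , q , refl , +≤+ d≤u , +≤+ u+d≤K) =
      subst (d ℕ.≤_) (sym (∣r+qK∣≡r⊓[K∸r] q (ℕ.<-≤-trans 0<d d≤u) u<K)) (ℕ.⊓-glb d≤u d≤K∸u)
      where
      u<K = ℕ.<-≤-trans (ℕ.m<m+n u 0<d) u+d≤K
      d≤K∸u = ℕ.m+n≤o⇒m≤o∸n d (subst (ℕ._≤ K) (ℕ.+-comm u d) u+d≤K)

    InArc-%ℕ : ∀ {d} σ x y → InArc (+ K) d (x - σ · y) →
      InArc (+ K) d (+ (x %ℕ K) - σ · (+ (y %ℕ K)))
    InArc-%ℕ {d} σ x y arc = subst (InArc (+ K) d) (sym (shift σ)) (InArc-shift (σ · q′ - q) arc′)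
      where
      q = x /ℕ K
      q′ = y /ℕ K
      arc′ : InArc (+ K) d (+ (x %ℕ K) + q * + K - σ · (+ (y %ℕ K) + q′ * + K))
      arc′ = subst₂ (λ a b → InArc (+ K) d (a - σ · b))
                    (a≡a%ℕn+[a/ℕn]*n x K) (a≡a%ℕn+[a/ℕn]*n y K) arc
      shift-plus : ∀ a b q q′ k → a - b ≡ a + q * k - (b + q′ * k) + (q′ - q) * k
      shift-plus = solve-∀
      shift-minus : ∀ a b q q′ k → a - - b ≡ a + q * k - - (b + q′ * k) + (- q′ - q) * k
      shift-minus = solve-∀
      shift : ∀ σ → + (x %ℕ K) - σ · (+ (y %ℕ K))
                  ≡ + (x %ℕ K) + q * + K - σ · (+ (y %ℕ K) + q′ * + K) + (σ · q′ - q) * + K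
      shift plus  = shift-plus  (+ (x %ℕ K)) (+ (y %ℕ K)) q q′ (+ K)
      shift minus = shift-minus (+ (x %ℕ K)) (+ (y %ℕ K)) q q′ (+ K)

open Residues

module Contraction (s : ℕ) where

  open import Data.Nat as ℕ using ()
  import Data.Nat.Properties as ℕ
  open import Data.Sum using (inj₁; inj₂)
  open import Data.Integer using (ℤ; +_; -_; _+_; _-_; _*_; _≤_; +≤+; ∣_∣; 0ℤ; 1ℤ; -1ℤ)
  open import Data.Integer.Properties
  open import Data.Integer.DivMod using (_%ℕ_; _/ℕ_)
  open import Data.Integer.Tactic.RingSolver using (solve-∀)

  t : ℕ
  t = ℕ.suc (ℕ.suc s)

  g : ℤ → ℤ
  g x = x /ℕ t * + s + + ℕ.pred (x %ℕ t)

  g[r+qt]≡qs+pred[r] : ∀ {r} q → r ℕ.< t → g (+ r + q * + t) ≡ q * + s + + ℕ.pred r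
  g[r+qt]≡qs+pred[r] q r<t =
    cong₂ (λ p r → p * + s + + ℕ.pred r) ([r+qK]/ℕK≡q q r<t) ([r+qK]%ℕK≡r q r<t)

  g-periodic : ∀ x m → g (x + + t * m) ≡ g x + + s * m
  g-periodic x m with division {t} x
  ... | r , q , r<t , refl = begin
    g (+ r + q * + t + + t * m)      ≡⟨ cong g (regroup (+ r) q m (+ t)) ⟩
    g (+ r + (q + m) * + t)          ≡⟨ g[r+qt]≡qs+pred[r] (q + m) r<t ⟩
    (q + m) * + s + + ℕ.pred r       ≡⟨ distrib q m (+ s) (+ ℕ.pred r) ⟩
    q * + s + + ℕ.pred r + + s * m   ≡⟨ cong (_+ + s * m) (g[r+qt]≡qs+pred[r] q r<t) ⟨
    g (+ r + q * + t) + + s * m      ∎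
    where
    open ≡-Reasoning
    regroup : ∀ a q m k → a + q * k + k * m ≡ a + (q + m) * k
    regroup = solve-∀
    distrib : ∀ q m k c → (q + m) * k + c ≡ q * k + c + k * m
    distrib = solve-∀

  g-odd : ∀ x → g (- x) ≡ - g x
  g-odd x with division {t} x
  ... | ℕ.zero , q , 0<t , refl = begin
    g (- (+ 0 + q * + t))      ≡⟨ cong g (negate q (+ t)) ⟩
    g (+ 0 + (- q) * + t)      ≡⟨ g[r+qt]≡qs+pred[r] (- q) 0<t ⟩
    - q * + s + + 0            ≡⟨ negate′ q (+ s) ⟩
    - (q * + s + + 0)          ≡⟨ cong -_ (g[r+qt]≡qs+pred[r] q 0<t) ⟨
    - g (+ 0 + q * + t)        ∎
    where
    open ≡-Reasoning
    negate : ∀ q k → - (0ℤ + q * k) ≡ 0ℤ + (- q) * k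
    negate = solve-∀
    negate′ : ∀ q k → - q * k + 0ℤ ≡ - (q * k + 0ℤ)
    negate′ = solve-∀
  ... | ℕ.suc r , q , r<t , refl = begin
    g (- (+ ℕ.suc r + q * + t))                  ≡⟨ cong g (-[r+qK]≡[K∸r]+[-1-q]K q (ℕ.<⇒≤ r<t)) ⟩
    g (+ (t ℕ.∸ ℕ.suc r) + (-1ℤ - q) * + t)      ≡⟨ g[r+qt]≡qs+pred[r] (-1ℤ - q) t∸1+r<t ⟩
    (-1ℤ - q) * + s + + ℕ.pred (t ℕ.∸ ℕ.suc r)  ≡⟨ cong (λ c → (-1ℤ - q) * + s + c) pred[t∸1+r]≡s-r ⟩
    (-1ℤ - q) * + s + (+ s - + r)                ≡⟨ negate q (+ s) (+ r) ⟩
    - (q * + s + + r)                            ≡⟨ cong -_ (g[r+qt]≡qs+pred[r] q r<t) ⟨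
    - g (+ ℕ.suc r + q * + t)                    ∎
    where
    open ≡-Reasoning
    r≤s = ℕ.≤-pred (ℕ.≤-pred r<t)
    t∸1+r<t = ℕ.∸-monoʳ-< ℕ.z<s (ℕ.<⇒≤ r<t)
    pred[t∸1+r]≡s-r : + ℕ.pred (t ℕ.∸ ℕ.suc r) ≡ + s - + r
    pred[t∸1+r]≡s-r = trans (cong (λ n → + ℕ.pred n) (ℕ.+-∸-assoc 1 r≤s)) (+[n∸m]≡+n-+m r≤s)
    negate : ∀ q k c → (-1ℤ - q) * k + (k - c) ≡ - (q * k + c)
    negate = solve-∀

  g-· : ∀ σ x → g (σ · x) ≡ σ · g x
  g-· plus  x = refl
  g-· minus x = g-odd x

  g-step : ∀ x → g x ≤ g (x + 1ℤ)
  g-step x with division {t} x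
  ... | r , q , r<t , refl with ℕ.m≤n⇒m<n∨m≡n r<t
  ...   | inj₁ 1+r<t = begin
    g (+ r + q * + t)                ≡⟨ g[r+qt]≡qs+pred[r] q r<t ⟩
    q * + s + + ℕ.pred r             ≤⟨ +-monoʳ-≤ (q * + s) (+≤+ ℕ.pred[n]≤n) ⟩
    q * + s + + r                    ≡⟨ g[r+qt]≡qs+pred[r] q 1+r<t ⟨
    g (+ ℕ.suc r + q * + t)          ≡⟨ cong g (increment (+ r) q (+ t)) ⟨
    g (+ r + q * + t + 1ℤ)           ∎
    where
    open ≤-Reasoning
    increment : ∀ a q k → a + q * k + 1ℤ ≡ 1ℤ + a + q * k
    increment = solve-∀
  ...   | inj₂ refl = ≤-reflexive (begin
    g (+ ℕ.suc s + q * + t)          ≡⟨ g[r+qt]≡qs+pred[r] q r<t ⟩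
    q * + s + + s                    ≡⟨ carry q (+ s) ⟩
    (q + 1ℤ) * + s + 0ℤ              ≡⟨ g[r+qt]≡qs+pred[r] (q + 1ℤ) ℕ.z<s ⟨
    g (0ℤ + (q + 1ℤ) * + t)          ≡⟨ cong g (wrap (+ s) q) ⟨
    g (+ ℕ.suc s + q * + t + 1ℤ)     ∎)
    where
    open ≡-Reasoning
    carry : ∀ q k → q * k + k ≡ (q + 1ℤ) * k + 0ℤ
    carry = solve-∀
    -- 1ℤ + + s and + 2 + + s reduce to + suc s and + t
    wrap : ∀ k q → 1ℤ + k + q * (+ 2 + k) + 1ℤ ≡ 0ℤ + (q + 1ℤ) * (+ 2 + k)
    wrap = solve-∀

  g-mono-+ : ∀ x n → g x ≤ g (x + + n)
  g-mono-+ x ℕ.zero    = ≤-reflexive (cong g (sym (+-identityʳ x)))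
  g-mono-+ x (ℕ.suc n) =
    ≤-trans (g-mono-+ x n) (subst (λ y → g (x + + n) ≤ g y) (shift x (+ n)) (g-step (x + + n)))
    where
    shift : ∀ x m → x + m + 1ℤ ≡ x + (1ℤ + m)
    shift = solve-∀

  g-mono : ∀ {x y} → x ≤ y → g x ≤ g y
  g-mono {x} {y} x≤y = subst (λ z → g x ≤ g z) x+[y-x]≡y (g-mono-+ x ∣ y - x ∣)
    where
    cancel : ∀ x y → x + (y - x) ≡ y
    cancel = solve-∀
    x+[y-x]≡y : x + + ∣ y - x ∣ ≡ y
    x+[y-x]≡y = trans (cong (_+_ x) (0≤i⇒+∣i∣≡i (i≤j⇒0≤j-i x≤y))) (cancel x y)

  g-arc : ∀ k d {z y} → InArc (+ t * + k) (+ t * + d) y →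
    InArc (+ s * + k) (+ s * + d) (g (z + y) - g z)
  g-arc k d {z} (w , q , refl , td≤w , w+td≤tk) =
    subst (InArc (+ s * + k) (+ s * + d)) difference (InArc-shift q (InArc-between lower upper))
    where
    lower : g z + + s * + d ≤ g (z + w)
    lower = begin
      g z + + s * + d         ≡⟨ g-periodic z (+ d) ⟨
      g (z + + t * + d)       ≤⟨ g-mono (+-monoʳ-≤ z td≤w) ⟩
      g (z + w)               ∎
      where open ≤-Reasoning
    upper : g (z + w) + + s * + d ≤ g z + + s * + k
    upper = begin
      g (z + w) + + s * + d   ≡⟨ g-periodic (z + w) (+ d) ⟨
      g (z + w + + t * + d)   ≤⟨ g-mono (≤-trans (≤-reflexive (+-assoc z w _)) (+-monoʳ-≤ z w+td≤tk)) ⟩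
      g (z + + t * + k)       ≡⟨ g-periodic z (+ k) ⟩
      g z + + s * + k         ∎
      where open ≤-Reasoning
    regroup : ∀ a b q s k → a - b + q * (s * k) ≡ a + s * (q * k) - b
    regroup = solve-∀
    reassoc : ∀ z w q t k → z + w + t * (q * k) ≡ z + (w + q * (t * k))
    reassoc = solve-∀
    difference : g (z + w) - g z + q * (+ s * + k) ≡ g (z + (w + q * (+ t * + k))) - g z
    difference = begin
      g (z + w) - g z + q * (+ s * + k)       ≡⟨ regroup (g (z + w)) (g z) q (+ s) (+ k) ⟩
      g (z + w) + + s * (q * + k) - g z       ≡⟨ cong (_- g z) (g-periodic (z + w) (q * + k)) ⟨
      g (z + w + + t * (q * + k)) - g z       ≡⟨ cong (λ y → g y - g z) (reassoc z w q (+ t) (+ k)) ⟩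
      g (z + (w + q * (+ t * + k))) - g z     ∎
      where open ≡-Reasoning

  g-edge : ∀ k d σ a b → InArc (+ t * + k) (+ t * + d) (a - σ · b) →
    InArc (+ s * + k) (+ s * + d) (g a - σ · g b)
  g-edge k d σ a b arc =
    subst (InArc (+ s * + k) (+ s * + d)) (cong₂ _-_ (cong g (cancel (σ · b) a)) (g-· σ b))
      (g-arc k d {σ · b} arc)
    where
    cancel : ∀ c a → c + (a - c) ≡ a
    cancel = solve-∀

open import Data.Nat using (_*_; _∸_; _≤_; _≥_; _<_; NonZero; s≤s)
open import Data.Nat.GCD using (gcd)
open import Data.Nat.Properties using (m*n≢0; m≤n*m; <-≤-trans; *-distribʳ-∸)
open import Data.Fin using (Fin; toℕ; fromℕ<)
open import Data.Fin.Properties using (toℕ-fromℕ<)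
import Data.Integer as ℤ
open import Data.Integer using (+_)
open import Data.Integer.Properties using (pos-*)
open import Data.Integer.DivMod using (_%ℕ_; n%ℕd<d)

module _ (G : SignedGraph) {s k : ℕ} .{{_ : NonZero s}} .{{_ : NonZero k}} where

  open Contraction s

  private instance
    sk≢0 = m*n≢0 s k
    tk≢0 = m*n≢0 t k

  HasKDColoring-contract : ∀ {d} → 0 < d →
    HasKDColoring G (t * k) (t * d) → HasKDColoring G (s * k) (s * d)
  HasKDColoring-contract {d} 0<d (c , c-proper) = c′ , c′-proper
    where
    c′ : Fin (n G) → Fin (s * k)
    c′ v = fromℕ< (n%ℕd<d (g (+ toℕ (c v))) (s * k))
    c′-proper : IsKDColoring G (s * k) (s * d) c′
    c′-proper {v} {w} e
      rewrite toℕ-fromℕ< (n%ℕd<d (g (+ toℕ (c v))) (s * k))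
            | toℕ-fromℕ< (n%ℕd<d (g (+ toℕ (c w))) (s * k)) =
      InArc⇒≤∣x∣ (<-≤-trans 0<d (m≤n*m d s)) (InArc-%ℕ σₑ (g a) (g b) target-arc)
      where
      σₑ = σ G e
      a = + toℕ (c v)
      b = + toℕ (c w)
      source-arc : InArc (+ t ℤ.* + k) (+ t ℤ.* + d) (a ℤ.- σₑ · b)
      source-arc = subst₂ (λ K D → InArc K D (a ℤ.- σₑ · b)) (pos-* t k) (pos-* t d)
                          (≤∣x∣⇒InArc _ (c-proper e))
      target-arc : InArc (+ (s * k)) (+ (s * d)) (g a ℤ.- σₑ · g b)
      target-arc = subst₂ (λ K D → InArc K D (g a ℤ.- σₑ · g b)) (sym (pos-* s k)) (sym (pos-* s d))
                          (g-edge k d σₑ a b source-arc)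

lemma3 : (d k t : ℕ) → 1 ≤ d → 1 ≤ k → t ≥ 3 → gcd k d ≡ 1 →
    2 * d ≤ k → (G : SignedGraph) →
    HasKDColoring G (t * k) (t * d) →
    HasKDColoring G (t * k ∸ 2 * k) (t * d ∸ 2 * d)
lemma3 d k t 1≤d (s≤s _) (s≤s (s≤s (s≤s _))) _ _ G coloring =
  subst₂ (HasKDColoring G) (*-distribʳ-∸ k t 2) (*-distribʳ-∸ d t 2)
    (HasKDColoring-contract G {t ∸ 2} 1≤d coloring)
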